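{- Let $\Gamma$ be a typing context, $x$ a variable not declared in $\Gamma$, $\tau,\sigma$ types, and $s,t$ unrestricted $\lambda_\epsilon$-terms with $\Gamma, x:\tau\vdash s:\sigma$ and $\Gamma\vdash t:\tau$. Then (i) $\Gamma\vdash s[t/x]:\sigma$, and (ii) $\Gamma, x:\tau\vdash\frac{\partial s}{\partial x}(t):\sigma$.
   Context: Unrestricted terms: $t ::= x \mid \lambda x.t \mid (s\ t) \mid \mathsf{D}(s)\cdot t \mid \epsilon t \mid s+t \mid 0$, up to $\alpha$-equivalence. $t[s/x]$ is capture-avoiding substitution. Differential substitution $\frac{\partial t}{\partial x}(s)$ (for $x$ not free in $s$): $\frac{\partial x}{\partial x}(s)=s$; $\frac{\partial y}{\partial x}(s)=0$ ($y\ne x$); $\frac{\partial(\lambda y.t)}{\partial x}(s)=\lambda y.\frac{\partial t}{\partial x}(s)$; $\frac{\partial(t\ e)}{\partial x}(s)=\big((\mathsf{D}(t)\cdot\frac{\partial e}{\partial x}(s))\ e\big)+\big(\frac{\partial t}{\partial x}(s)\ (e[x+\epsilon s/x])\big)$; $\frac{\partial(\mathsf{D}(t)\cdot e)}{\partial x}(s)=\mathsf{D}(t)\cdot\frac{\partial e}{\partial x}(s)+\mathsf{D}(\frac{\partial t}{\partial x}(s))\cdot(e[x+\epsilon s/x])+\epsilon\big(\mathsf{D}(\mathsf{D}(t)\cdot e)\cdot\frac{\partial e}{\partial x}(s)\big)$; $\frac{\partial(\epsilon t)}{\partial x}(s)=\epsilon\frac{\partial t}{\partial x}(s)$; $\frac{\partial(t+e)}{\partial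 x}(s)=\frac{\partial t}{\partial x}(s)+\frac{\partial e}{\partial x}(s)$; $\frac{\partial 0}{\partial x}(s)=0$. Types: $\sigma,\tau ::= \mathbf{t}\mid\sigma\Rightarrow\tau$ over a countable set of base types; contexts are finite lists $x_1:\tau_1,\ldots,x_n:\tau_n$ of distinct variables. Typing rules: $\Gamma\vdash x:\tau$ if $x:\tau$ occurs in $\Gamma$; from $\Gamma\vdash s:\tau\Rightarrow\sigma$ and $\Gamma\vdash t:\tau$ infer $\Gamma\vdash(s\ t):\sigma$ and $\Gamma\vdash\mathsf{D}(s)\cdot t:\tau\Rightarrow\sigma$; from $\Gamma,x:\tau\vdash t:\sigma$ infer $\Gamma\vdash\lambda x.t:\tau\Rightarrow\sigma$; $\Gamma\vdash 0:\tau$ for every $\tau$; from $\Gamma\vdash s:\tau$ and $\Gamma\vdash t:\tau$ infer $\Gamma\vdash s+t:\tau$; from $\Gamma\vdash t:\tau$ infer $\Gamma\vdash\epsilon t:\tau$. -}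

module Defs where

open import Data.Nat using (ℕ; zero; suc; _≡ᵇ_)
open import Data.Bool using (if_then_else_)
open import Data.List using (List; []; _∷_)

-- Unrestricted λε-terms, up to α-equivalence, via de Bruijn indices.
-- var n is the variable bound by the n-th enclosing binder / n-th most recent
-- context entry.
data Term : Set where
  var  : ℕ → Term
  lam  : Term → Term
  app  : Term → Term → Term
  D_·_ : Term → Term → Term
  ε_   : Term → Term
  _⊕_  : Term → Term → Term
  `0   : Term

infixl 6 _⊕_

ext : (ℕ → ℕ) → ℕ → ℕ
ext ρ zero    = zero
ext ρ (suc n) = suc (ρ n)

rename : (ℕ → ℕ) → Term → Term
rename ρ (var n)   = var (ρ n)
rename ρ (lam t)   = lam (rename (ext ρ) t)
rename ρ (app s t) = app (rename ρ s) (rename ρ t)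
rename ρ (D s · t) = D rename ρ s · rename ρ t
rename ρ (ε t)     = ε rename ρ t
rename ρ (s ⊕ t)   = rename ρ s ⊕ rename ρ t
rename ρ `0        = `0

weaken : Term → Term
weaken = rename suc

exts : (ℕ → Term) → ℕ → Term
exts σ zero    = var zero
exts σ (suc n) = weaken (σ n)

subst : (ℕ → Term) → Term → Term
subst σ (var n)   = σ n
subst σ (lam t)   = lam (subst (exts σ) t)
subst σ (app s t) = app (subst σ s) (subst σ t)
subst σ (D s · t) = D subst σ s · subst σ t
subst σ (ε t)     = ε subst σ t
subst σ (s ⊕ t)   = subst σ s ⊕ subst σ t
subst σ `0        = `0

-- Single substitution  s[t/x]  where x is the variable 0 (last context entry);
-- the remaining variables are shifted down.
singleSub : Term → ℕ → Term
singleSub t zero    = t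
singleSub t (suc n) = var n

_[_] : Term → Term → Term
s [ t ] = subst (singleSub t) s

-- Substitution  [x + ε s / x]  for x = var k (x stays in scope; others fixed)
plusSub : ℕ → Term → ℕ → Term
plusSub k s n = if n ≡ᵇ k then (var k ⊕ (ε s)) else var n

-- Differential substitution  ∂t/∂x(s)  with x = var k
-- (s is assumed not to contain var k free; under a binder x becomes var (suc k)
-- and s is weakened).
∂ : ℕ → Term → Term → Term
∂ k (var n)   s = if n ≡ᵇ k then s else `0
∂ k (lam t)   s = lam (∂ (suc k) t (weaken s))
∂ k (app t e) s = app (D t · ∂ k e s) e ⊕ app (∂ k t s) (subst (plusSub k s) e)
∂ k (D t · e) s = (D t · ∂ k e s) ⊕ (D (∂ k t s) · subst (plusSub k s) e)
                    ⊕ (ε (D (D t · e) · ∂ k e s))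
∂ k (ε t)     s = ε (∂ k t s)
∂ k (t ⊕ e)   s = ∂ k t s ⊕ ∂ k e s
∂ k `0        s = `0

data Type : Set where
  base : ℕ → Type
  _⇒_  : Type → Type → Type

infixr 7 _⇒_

-- Contexts: the head is the most recently declared variable (index 0);
-- "Γ, x:τ" is  τ ∷ Γ.
Ctx : Set
Ctx = List Type

data _∋_⦂_ : Ctx → ℕ → Type → Set where
  here  : ∀ {Γ τ} → (τ ∷ Γ) ∋ zero ⦂ τ
  there : ∀ {Γ n τ σ} → Γ ∋ n ⦂ τ → (σ ∷ Γ) ∋ suc n ⦂ τ

infix 4 _⊢_⦂_
data _⊢_⦂_ : Ctx → Term → Type → Set where
  ⊢var : ∀ {Γ n τ} → Γ ∋ n ⦂ τ → Γ ⊢ var n ⦂ τ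
  ⊢app : ∀ {Γ s t τ σ} → Γ ⊢ s ⦂ τ ⇒ σ → Γ ⊢ t ⦂ τ → Γ ⊢ app s t ⦂ σ
  ⊢D   : ∀ {Γ s t τ σ} → Γ ⊢ s ⦂ τ ⇒ σ → Γ ⊢ t ⦂ τ → Γ ⊢ D s · t ⦂ τ ⇒ σ
  ⊢lam : ∀ {Γ t τ σ} → (τ ∷ Γ) ⊢ t ⦂ σ → Γ ⊢ lam t ⦂ τ ⇒ σ
  ⊢0   : ∀ {Γ τ} → Γ ⊢ `0 ⦂ τ
  ⊢+   : ∀ {Γ s t τ} → Γ ⊢ s ⦂ τ → Γ ⊢ t ⦂ τ → Γ ⊢ s ⊕ t ⦂ τ
  ⊢ε   : ∀ {Γ t τ} → Γ ⊢ t ⦂ τ → Γ ⊢ ε t ⦂ τ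

module Submission where

open import Data.Bool using (true; false; if_then_else_)
open import Data.Bool.Properties using (T-≡)
open import Data.List using (_∷_)
open import Data.Nat using (ℕ; _≡ᵇ_)
open import Data.Nat.Properties using (≡ᵇ⇒≡)
open import Data.Product using (_×_; _,_)
open import Function.Bundles using (module Equivalence)
open import Relation.Binary.PropositionalEquality using (_≡_; refl)

open import Defs

-- Part (i) is the usual substitution lemma for a well-typed parallel substitution.
-- Part (ii) is an induction on the typing of s, generalised to differentiation in
-- an arbitrary variable k since under λ the variable x becomes k + 1: every clause
-- of ∂ rebuilds typed subterms with typed constructors, and [x + ε s / x] is a
-- well-typed substitution because x + ε s has the type of x.

∋-functional : ∀ {Γ n A B} → Γ ∋ n ⦂ A → Γ ∋ n ⦂ B → A ≡ B
∋-functional here      here      = refl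
∋-functional (there x) (there y) = ∋-functional x y

⊢-if-≡ᵇ : ∀ {Γ n k A B u v} → Γ ∋ n ⦂ A → Γ ∋ k ⦂ B
        → Γ ⊢ u ⦂ B → Γ ⊢ v ⦂ A → Γ ⊢ (if n ≡ᵇ k then u else v) ⦂ A
⊢-if-≡ᵇ {n = n} {k} x y ⊢u ⊢v with n ≡ᵇ k in n≡ᵇk
... | false = ⊢v
... | true with refl ← ≡ᵇ⇒≡ n k (Equivalence.from T-≡ n≡ᵇk)
           with refl ← ∋-functional x y = ⊢u

Renaming : Ctx → Ctx → (ℕ → ℕ) → Set
Renaming Γ Δ ρ = ∀ {n A} → Γ ∋ n ⦂ A → Δ ∋ ρ n ⦂ A

⊢-ext : ∀ {Γ Δ ρ B} → Renaming Γ Δ ρ → Renaming (B ∷ Γ) (B ∷ Δ) (ext ρ)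
⊢-ext ⊢ρ here      = here
⊢-ext ⊢ρ (there x) = there (⊢ρ x)

⊢-rename : ∀ {Γ Δ ρ t A} → Renaming Γ Δ ρ → Γ ⊢ t ⦂ A → Δ ⊢ rename ρ t ⦂ A
⊢-rename ⊢ρ (⊢var x)   = ⊢var (⊢ρ x)
⊢-rename ⊢ρ (⊢app d e) = ⊢app (⊢-rename ⊢ρ d) (⊢-rename ⊢ρ e)
⊢-rename ⊢ρ (⊢D d e)   = ⊢D (⊢-rename ⊢ρ d) (⊢-rename ⊢ρ e)
⊢-rename ⊢ρ (⊢lam d)   = ⊢lam (⊢-rename (⊢-ext ⊢ρ) d)
⊢-rename ⊢ρ ⊢0         = ⊢0
⊢-rename ⊢ρ (⊢+ d e)   = ⊢+ (⊢-rename ⊢ρ d) (⊢-rename ⊢ρ e)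
⊢-rename ⊢ρ (⊢ε d)     = ⊢ε (⊢-rename ⊢ρ d)

⊢-weaken : ∀ {Γ t A B} → Γ ⊢ t ⦂ A → (B ∷ Γ) ⊢ weaken t ⦂ A
⊢-weaken = ⊢-rename there

Substitution : Ctx → Ctx → (ℕ → Term) → Set
Substitution Γ Δ σ = ∀ {n A} → Γ ∋ n ⦂ A → Δ ⊢ σ n ⦂ A

⊢-exts : ∀ {Γ Δ σ B} → Substitution Γ Δ σ → Substitution (B ∷ Γ) (B ∷ Δ) (exts σ)
⊢-exts ⊢σ here      = ⊢var here
⊢-exts ⊢σ (there x) = ⊢-weaken (⊢σ x)

⊢-subst : ∀ {Γ Δ σ t A} → Substitution Γ Δ σ → Γ ⊢ t ⦂ A → Δ ⊢ subst σ t ⦂ A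
⊢-subst ⊢σ (⊢var x)   = ⊢σ x
⊢-subst ⊢σ (⊢app d e) = ⊢app (⊢-subst ⊢σ d) (⊢-subst ⊢σ e)
⊢-subst ⊢σ (⊢D d e)   = ⊢D (⊢-subst ⊢σ d) (⊢-subst ⊢σ e)
⊢-subst ⊢σ (⊢lam d)   = ⊢lam (⊢-subst (⊢-exts ⊢σ) d)
⊢-subst ⊢σ ⊢0         = ⊢0
⊢-subst ⊢σ (⊢+ d e)   = ⊢+ (⊢-subst ⊢σ d) (⊢-subst ⊢σ e)
⊢-subst ⊢σ (⊢ε d)     = ⊢ε (⊢-subst ⊢σ d)

⊢-singleSub : ∀ {Γ t B} → Γ ⊢ t ⦂ B → Substitution (B ∷ Γ) Γ (singleSub t)
⊢-singleSub ⊢t here      = ⊢t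
⊢-singleSub ⊢t (there x) = ⊢var x

⊢-plusSub : ∀ {Γ k s B} → Γ ∋ k ⦂ B → Γ ⊢ s ⦂ B → Substitution Γ Γ (plusSub k s)
⊢-plusSub y ⊢s x = ⊢-if-≡ᵇ x y (⊢+ (⊢var y) (⊢ε ⊢s)) (⊢var x)

⊢-∂ : ∀ {Γ k s B t A} → Γ ∋ k ⦂ B → Γ ⊢ s ⦂ B → Γ ⊢ t ⦂ A → Γ ⊢ ∂ k t s ⦂ A
⊢-∂ y ⊢s (⊢var x)   = ⊢-if-≡ᵇ x y ⊢s ⊢0
⊢-∂ y ⊢s (⊢app d e) =
  ⊢+ (⊢app (⊢D d (⊢-∂ y ⊢s e)) e) (⊢app (⊢-∂ y ⊢s d) (⊢-subst (⊢-plusSub y ⊢s) e))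
⊢-∂ y ⊢s (⊢D d e)   =
  ⊢+ (⊢+ (⊢D d (⊢-∂ y ⊢s e)) (⊢D (⊢-∂ y ⊢s d) (⊢-subst (⊢-plusSub y ⊢s) e)))
     (⊢ε (⊢D (⊢D d e) (⊢-∂ y ⊢s e)))
⊢-∂ y ⊢s (⊢lam d)   = ⊢lam (⊢-∂ (there y) (⊢-weaken ⊢s) d)
⊢-∂ y ⊢s ⊢0         = ⊢0
⊢-∂ y ⊢s (⊢+ d e)   = ⊢+ (⊢-∂ y ⊢s d) (⊢-∂ y ⊢s e)
⊢-∂ y ⊢s (⊢ε d)     = ⊢ε (⊢-∂ y ⊢s d)

mainTheorem12 : ∀ (Γ : Ctx) (τ σ : Type) (s t : Term)
    → (τ ∷ Γ) ⊢ s ⦂ σ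
    → Γ ⊢ t ⦂ τ
    → (Γ ⊢ s [ t ] ⦂ σ) × ((τ ∷ Γ) ⊢ ∂ 0 s (weaken t) ⦂ σ)
mainTheorem12 Γ τ σ s t ⊢s ⊢t = ⊢-subst (⊢-singleSub ⊢t) ⊢s , ⊢-∂ here (⊢-weaken ⊢t) ⊢s
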